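{- Let $p$ be an odd prime. Then: (i) $\mathcal{C}^t((p+1)/2)=(p+1)/2$ for every $t\in\mathbb{N}$; (ii) $\{\mathcal{C}^t(0): t=0,1,\dots,p-2\}=\{0,1,\dots,(p-1)/2,(p+3)/2,\dots,p-1\}\bmod p$, and $\mathcal{C}^{p-2}(0)=1\bmod p$.
   Context: $\mathcal{C}:(\mathbb{Z}/p\mathbb{Z})\setminus\{1\}\to\mathbb{Z}/p\mathbb{Z}$ is $\mathcal{C}(R)=\frac{1}{4(1-R)}$. $\mathcal{C}^t$ is the $t$-fold iterate (defined when none of $R,\mathcal{C}(R),\dots,\mathcal{C}^{t-1}(R)$ is $1\bmod p$), and $\mathcal{C}^0$ is the identity. -}

module Defs where

open import Data.Nat using (ℕ; zero; suc; _+_; _*_; _∸_; _<_; _%_; NonZero)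
open import Relation.Binary.PropositionalEquality using (_≡_; _≢_)
open import Data.Product using (_×_)

-- Elements of ℤ/pℤ are represented by their canonical residues 0 ≤ R < p.
-- For R < p, the residue of (1 - R) mod p is (p + 1 ∸ R) (reduced mod p).

-- CStep p R S  :  R ≢ 1 (mod p) and S = 𝒞(R) = 1 / (4 (1 - R)) in ℤ/pℤ,
-- i.e. S is the residue with 4 (1 - R) S ≡ 1 (mod p).
-- (For p prime this S exists and is unique whenever R ≢ 1.)
record CStep (p : ℕ) .{{_ : NonZero p}} (R S : ℕ) : Set where
  constructor cstep
  field
    R<p  : R < p
    S<p  : S < p
    R≢1  : R ≢ 1
    inv  : (4 * (suc p ∸ R) * S) % p ≡ 1 % p

data CIter (p : ℕ) .{{_ : NonZero p}} : ℕ → ℕ → ℕ → Set where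
  iter-zero : ∀ {R} → R < p → CIter p zero R R
  iter-suc  : ∀ {t R S T} → CStep p R S → CIter p t S T → CIter p (suc t) R T

{-# OPTIONS --safe #-}
-- The orbit of 0 has the closed form 𝒞^t(0) = t / (2 (t + 1)) in ℤ/pℤ: if 2(t+1)x ≡ t and
-- 2(t+2)y ≡ t+1, clearing the denominators (units for t ≤ p − 2) gives 4(1 − x)y ≡ 1.
-- At t = p − 2 the closed form is (p − 2)/(2(p − 1)) ≡ 1. Conversely 2(t+1)x ≡ t is the linear
-- equation (2x − 1)t ≡ −2x, so every x ≢ 1/2 is hit by exactly one t, and that t is not ≡ −1,
-- while x = 1/2 = (p + 1)/2 is never hit. It is instead a fixed point: 4(1 − 1/2)(1/2) ≡ 1.
-- Since 𝒞 is a function, iterates are unique, so the closed form describes the actual orbit.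
module Submission where

open import Defs
open import Data.Nat as ℕ using (ℕ; zero; suc; _<_; _≤_; NonZero; z<s; s≤s)
open import Data.Product using (∃-syntax; _×_; _,_; proj₁)
open import Data.List using (_∷_; [])
open import Relation.Nullary using (¬_; yes; no)
open import Data.Nat.Primality using (Prime; prime⇒irreducible)
open import Data.Nat.DivMod using (m%n<n; %-distribˡ-+; m*[n/m]≡n)
open import Data.Nat.Divisibility using (m%n≡0⇒n∣m)
open import Data.Empty using (⊥-elim)
open import Data.Sum using ([_,_]′)
open import Function using (_∘_)
open import Relation.Binary.PropositionalEquality using (_≡_; _≢_; refl; sym; trans; cong; subst)
open import Relation.Binary.Structures using (IsEquivalence)
open import Relation.Binary.Bundles using (Setoid)
import Relation.Binary.Reasoning.Setoid as SetoidReasoning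

module Congruence (m : ℕ) .{{_ : NonZero m}} where

  open import Data.Integer using (ℤ; +_; -_; _+_; _-_; _*_; 0ℤ; 1ℤ; _%ℕ_; _/ℕ_)
  open import Data.Integer.Properties using (m-n≡m⊖n; ⊖-≤; neg-involutive; neg-distribˡ-*; *-comm; +-identityʳ)
  open import Data.Integer.DivMod using (n%ℕd<d; a≡a%ℕn+[a/ℕn]*n)
  open import Data.Integer.Divisibility.Signed
    using (_∣_; divides; ∣-refl; ∣m⇒∣-m; ∣m∣n⇒∣m+n; ∣m∣n⇒∣m-n; ∣n⇒∣m*n; ∣⇒∣ᵤ)
  open import Data.Integer.Tactic.RingSolver using (solve-∀; solve)
  open import Data.Nat.Properties using (≤-total; ≤-antisym; m∸n≡0⇒m≤n; m∸n≤m; ≤-<-trans)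
  open import Data.Nat.DivMod using (m<n⇒m%n≡m)
  open import Data.Nat.Divisibility using (n∣m⇒m%n≡0)
  open import Data.Sum using (inj₁; inj₂)

  infix 4 _≈_
  record _≈_ (a b : ℤ) : Set where
    constructor mk≈
    field m∣a-b : + m ∣ a - b

  ≈-by-difference : ∀ {a b d} → + m ∣ d → a - b ≡ d → a ≈ b
  ≈-by-difference m∣d eq = mk≈ (subst (+ m ∣_) (sym eq) m∣d)

  ≈-reflexive : ∀ {a b} → a ≡ b → a ≈ b
  ≈-reflexive {a} refl = ≈-by-difference (divides 0ℤ refl) (solve (a ∷ []))

  ≈-refl : ∀ {a} → a ≈ a
  ≈-refl = ≈-reflexive refl

  ≈-sym : ∀ {a b} → a ≈ b → b ≈ a
  ≈-sym {a} {b} (mk≈ d) = ≈-by-difference (∣m⇒∣-m d) (solve (a ∷ b ∷ []))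

  ≈-trans : ∀ {a b c} → a ≈ b → b ≈ c → a ≈ c
  ≈-trans {a} {b} {c} (mk≈ d) (mk≈ e) = ≈-by-difference (∣m∣n⇒∣m+n d e) (solve (a ∷ b ∷ c ∷ []))

  ≈-isEquivalence : IsEquivalence _≈_
  ≈-isEquivalence = record { refl = ≈-refl ; sym = ≈-sym ; trans = ≈-trans }

  ≈-setoid : Setoid _ _
  ≈-setoid = record { isEquivalence = ≈-isEquivalence }

  module ≈-Reasoning = SetoidReasoning ≈-setoid

  +-cong : ∀ {a b c d} → a ≈ b → c ≈ d → a + c ≈ b + d
  +-cong {a} {b} {c} {d} (mk≈ e) (mk≈ f) = ≈-by-difference (∣m∣n⇒∣m+n e f) (solve (a ∷ b ∷ c ∷ d ∷ []))

  -‿cong : ∀ {a b c d} → a ≈ b → c ≈ d → a - c ≈ b - d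
  -‿cong {a} {b} {c} {d} (mk≈ e) (mk≈ f) = ≈-by-difference (∣m∣n⇒∣m-n e f) (solve (a ∷ b ∷ c ∷ d ∷ []))

  *-cong : ∀ {a b c d} → a ≈ b → c ≈ d → a * c ≈ b * d
  *-cong {a} {b} {c} {d} (mk≈ e) (mk≈ f) =
    ≈-by-difference (∣m∣n⇒∣m+n (∣n⇒∣m*n c e) (∣n⇒∣m*n b f)) (solve (a ∷ b ∷ c ∷ d ∷ []))

  a+k*m≈a : ∀ a k → a + k * + m ≈ a
  a+k*m≈a a k = ≈-by-difference (∣n⇒∣m*n k ∣-refl) (identity a k (+ m))
    where
    identity : ∀ a k M → (a + k * M) - a ≡ k * M
    identity = solve-∀

  residue-≈ : ∀ z → + (z %ℕ m) ≈ z
  residue-≈ z = ≈-sym (subst (_≈ + (z %ℕ m)) (sym (a≡a%ℕn+[a/ℕn]*n z m)) (a+k*m≈a _ (z /ℕ m)))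

  ∣∧<⇒≡0 : ∀ {d} → + m ∣ + d → d < m → d ≡ 0
  ∣∧<⇒≡0 {d} m∣d d<m = trans (sym (m<n⇒m%n≡m d<m)) (n∣m⇒m%n≡0 d m (∣⇒∣ᵤ m∣d))

  ≤∧≈⇒≡ : ∀ {a b} → a ≤ b → b < m → + a ≈ + b → a ≡ b
  ≤∧≈⇒≡ {a} {b} a≤b b<m (mk≈ m∣a-b) = ≤-antisym a≤b (m∸n≡0⇒m≤n b∸a≡0)
    where
    m∣b∸a : + m ∣ + (b ℕ.∸ a)
    m∣b∸a = subst (+ m ∣_) (neg-involutive _)
              (∣m⇒∣-m (subst (+ m ∣_) (trans (m-n≡m⊖n a b) (⊖-≤ a≤b)) m∣a-b))
    b∸a≡0 : b ℕ.∸ a ≡ 0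
    b∸a≡0 = ∣∧<⇒≡0 m∣b∸a (≤-<-trans (m∸n≤m b a) b<m)

  residue-injective : ∀ {a b} → a < m → b < m → + a ≈ + b → a ≡ b
  residue-injective {a} {b} a<m b<m a≈b with ≤-total a b
  ... | inj₁ a≤b = ≤∧≈⇒≡ a≤b b<m a≈b
  ... | inj₂ b≤a = sym (≤∧≈⇒≡ b≤a a<m (≈-sym a≈b))

  %≡⇒≈ : ∀ {a b} → a ℕ.% m ≡ b ℕ.% m → + a ≈ + b
  %≡⇒≈ {a} {b} eq =
    ≈-trans (≈-sym (residue-≈ (+ a))) (≈-trans (≈-reflexive (cong +_ eq)) (residue-≈ (+ b)))

  ≈⇒%≡ : ∀ {a b} → + a ≈ + b → a ℕ.% m ≡ b ℕ.% m
  ≈⇒%≡ {a} {b} a≈b = residue-injective (m%n<n a m) (m%n<n b m)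
    (≈-trans (residue-≈ (+ a)) (≈-trans a≈b (≈-sym (residue-≈ (+ b)))))

  +m≈0 : + m ≈ 0ℤ
  +m≈0 = ≈-by-difference ∣-refl (+-identityʳ (+ m))

  +[1+m]≈1 : + suc m ≈ 1ℤ
  +[1+m]≈1 = +-cong (≈-refl {1ℤ}) +m≈0

  record Invertible (c : ℤ) : Set where
    constructor invertible
    field
      inverse   : ℤ
      inverseʳ  : c * inverse ≈ 1ℤ

  *-invertible : ∀ {a b} → Invertible a → Invertible b → Invertible (a * b)
  *-invertible {a} {b} (invertible u au≈1) (invertible v bv≈1) = invertible (u * v) (begin
    a * b * (u * v)    ≡⟨ solve (a ∷ b ∷ u ∷ v ∷ []) ⟩
    (a * u) * (b * v)  ≈⟨ *-cong au≈1 bv≈1 ⟩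
    1ℤ                 ∎)
    where open ≈-Reasoning

  invertible-cancelˡ : ∀ {c a b} → Invertible c → c * a ≈ c * b → a ≈ b
  invertible-cancelˡ {c} {a} {b} (invertible u cu≈1) ca≈cb = begin
    a                ≡⟨ solve (a ∷ []) ⟩
    1ℤ * a           ≈⟨ *-cong cu≈1 (≈-refl {a}) ⟨
    (c * u) * a      ≡⟨ solve (c ∷ u ∷ a ∷ []) ⟩
    u * (c * a)      ≈⟨ *-cong (≈-refl {u}) ca≈cb ⟩
    u * (c * b)      ≡⟨ solve (c ∷ u ∷ b ∷ []) ⟩
    (c * u) * b      ≈⟨ *-cong cu≈1 (≈-refl {b}) ⟩
    1ℤ * b           ≡⟨ solve (b ∷ []) ⟩
    b                ∎
    where open ≈-Reasoning

  invertible-solve : ∀ {c} → Invertible c → ∀ d → ∃[ y ] (y < m × c * + y ≈ d)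
  invertible-solve {c} (invertible u cu≈1) d = (u * d) %ℕ m , n%ℕd<d (u * d) m , (begin
    c * + ((u * d) %ℕ m)  ≈⟨ *-cong (≈-refl {c}) (residue-≈ (u * d)) ⟩
    c * (u * d)           ≡⟨ solve (c ∷ u ∷ d ∷ []) ⟩
    (c * u) * d           ≈⟨ *-cong cu≈1 (≈-refl {d}) ⟩
    1ℤ * d                ≡⟨ solve (d ∷ []) ⟩
    d                     ∎)
    where open ≈-Reasoning

  bézout⇒invertible₁ : ∀ {r} x y → 1ℤ + y * r ≡ x * + m → Invertible r
  bézout⇒invertible₁ {r} x y eq = invertible (- y) (begin
    r * - y             ≡⟨ solve (r ∷ y ∷ []) ⟩
    1ℤ - (1ℤ + y * r)   ≡⟨ cong (λ k → 1ℤ - k) eq ⟩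
    1ℤ - x * + m        ≡⟨ cong (λ k → 1ℤ + k) (neg-distribˡ-* x (+ m)) ⟩
    1ℤ + - x * + m      ≈⟨ a+k*m≈a 1ℤ (- x) ⟩
    1ℤ                  ∎)
    where open ≈-Reasoning

  bézout⇒invertible₂ : ∀ {r} x y → 1ℤ + x * + m ≡ y * r → Invertible r
  bézout⇒invertible₂ {r} x y eq = invertible y (begin
    r * y           ≡⟨ *-comm r y ⟩
    y * r           ≡⟨ eq ⟨
    1ℤ + x * + m    ≈⟨ a+k*m≈a 1ℤ x ⟩
    1ℤ              ∎)
    where open ≈-Reasoning

  invertible-resp-≈ : ∀ {a b} → a ≈ b → Invertible a → Invertible b
  invertible-resp-≈ {a} {b} a≈b (invertible u au≈1) =
    invertible u (≈-trans (*-cong (≈-sym a≈b) (≈-refl {u})) au≈1)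

  a-1≈0⇒a≈1 : ∀ {a} → a - 1ℤ ≈ 0ℤ → a ≈ 1ℤ
  a-1≈0⇒a≈1 {a} a-1≈0 = begin
    a                ≡⟨ solve (a ∷ []) ⟩
    (a - 1ℤ) + 1ℤ    ≈⟨ +-cong a-1≈0 (≈-refl {1ℤ}) ⟩
    1ℤ               ∎
    where open ≈-Reasoning

CIter-snoc : ∀ {p} .{{_ : NonZero p}} {t R S T} → CIter p t R S → CStep p S T → CIter p (suc t) R T
CIter-snoc (iter-zero _)     S↦T = iter-suc S↦T (iter-zero (CStep.S<p S↦T))
CIter-snoc (iter-suc R↦S it) S↦T = iter-suc R↦S (CIter-snoc it S↦T)

CIter-fixed-point : ∀ {p} .{{_ : NonZero p}} {R} → CStep p R R → ∀ t → CIter p t R R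
CIter-fixed-point R↦R zero    = iter-zero (CStep.R<p R↦R)
CIter-fixed-point R↦R (suc t) = iter-suc R↦R (CIter-fixed-point R↦R t)

module CModulo (p : ℕ) .{{_ : NonZero p}} where

  open Congruence p
  open ≈-Reasoning
  open import Data.Integer using (ℤ; +_; -_; _+_; _-_; _*_; 0ℤ; 1ℤ)
  open import Data.Integer.Properties using (m-n≡m⊖n; ⊖-≥; pos-*)
  open import Data.Integer.Tactic.RingSolver using (solve)
  open import Data.Nat.Properties using (<-trans; n<1+n; <⇒≤; 0≢1+n)

  infix 4 _↦_
  _↦_ : ℤ → ℤ → Set
  r ↦ s = + 4 * (1ℤ - r) * s ≈ 1ℤ

  +[1+p∸R]≈1-R : ∀ {R} → R < p → + (suc p ℕ.∸ R) ≈ 1ℤ - + R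
  +[1+p∸R]≈1-R {R} R<p = begin
    + (suc p ℕ.∸ R)   ≡⟨ trans (m-n≡m⊖n (suc p) R) (⊖-≥ (<⇒≤ (<-trans R<p (n<1+n p)))) ⟨
    + suc p - + R     ≈⟨ -‿cong +[1+m]≈1 (≈-refl {+ R}) ⟩
    1ℤ - + R          ∎

  CStep-equation≈ : ∀ {R S} → R < p → + (4 ℕ.* (suc p ℕ.∸ R) ℕ.* S) ≈ + 4 * (1ℤ - + R) * + S
  CStep-equation≈ {R} {S} R<p = begin
    + (4 ℕ.* (suc p ℕ.∸ R) ℕ.* S)
      ≡⟨ trans (pos-* (4 ℕ.* (suc p ℕ.∸ R)) S) (cong (_* + S) (pos-* 4 (suc p ℕ.∸ R))) ⟩
    + 4 * + (suc p ℕ.∸ R) * + S    ≈⟨ *-cong (*-cong (≈-refl {+ 4}) (+[1+p∸R]≈1-R R<p)) (≈-refl {+ S}) ⟩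
    + 4 * (1ℤ - + R) * + S         ∎

  CStep⇒↦ : ∀ {R S} → CStep p R S → + R ↦ + S
  CStep⇒↦ (cstep R<p _ _ inv) = ≈-trans (≈-sym (CStep-equation≈ R<p)) (%≡⇒≈ inv)

  ↦⇒CStep : ∀ {R S} → 1 < p → R < p → S < p → + R ↦ + S → CStep p R S
  ↦⇒CStep {R} 1<p R<p S<p R↦S = cstep R<p S<p R≢1 (≈⇒%≡ (≈-trans (CStep-equation≈ R<p) R↦S))
    where
    -- at R = 1 the equation computes to 0 ≈ 1
    R≢1 : R ≢ 1
    R≢1 refl = 0≢1+n (residue-injective (<-trans z<s 1<p) 1<p R↦S)

  CStep-deterministic : ∀ {R S S′} → CStep p R S → CStep p R S′ → S ≡ S′
  CStep-deterministic {R} {S} {S′} R↦S R↦S′ = residue-injective (CStep.S<p R↦S) (CStep.S<p R↦S′)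
    (invertible-cancelˡ (invertible {+ 4 * (1ℤ - + R)} (+ S) (CStep⇒↦ R↦S))
      (≈-trans (CStep⇒↦ R↦S) (≈-sym (CStep⇒↦ R↦S′))))

  CIter-deterministic : ∀ {t R T T′} → CIter p t R T → CIter p t R T′ → T ≡ T′
  CIter-deterministic (iter-zero _) (iter-zero _) = refl
  CIter-deterministic (iter-suc R↦S it) (iter-suc R↦S′ it′) =
    CIter-deterministic it (subst (λ S → CIter p _ S _) (sym (CStep-deterministic R↦S R↦S′)) it′)

  half-↦-half : ∀ h → + 2 * h ≈ 1ℤ → h ↦ h
  half-↦-half h 2h≈1 = begin
    + 4 * (1ℤ - h) * h                  ≡⟨ solve (h ∷ []) ⟩
    + 2 * (+ 2 * h) - (+ 2 * h) * (+ 2 * h)  ≈⟨ -‿cong (*-cong (≈-refl {+ 2}) 2h≈1) (*-cong 2h≈1 2h≈1) ⟩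
    1ℤ                                  ∎

  -- x = t / (2 (t + 1)), the closed form of 𝒞^t(0); the successor is written 1ℤ + t since
  -- 1ℤ + + n is definitionally + suc n.
  ClosedForm : ℤ → ℤ → Set
  ClosedForm t x = + 2 * (1ℤ + t) * x ≈ t

  closedForm-↦ : ∀ t {x y} → Invertible (+ 2 * (1ℤ + t)) → Invertible (+ 2 * (1ℤ + (1ℤ + t))) →
                 ClosedForm t x → ClosedForm (1ℤ + t) y → x ↦ y
  closedForm-↦ t {x} {y} A⁻¹ B⁻¹ x≈ y≈ = invertible-cancelˡ (*-invertible A⁻¹ B⁻¹) (begin
    + 2 * (1ℤ + t) * (+ 2 * (1ℤ + (1ℤ + t))) * (+ 4 * (1ℤ - x) * y)
      ≡⟨ solve (t ∷ x ∷ y ∷ []) ⟩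
    + 4 * (+ 2 * (1ℤ + t) - + 2 * (1ℤ + t) * x) * (+ 2 * (1ℤ + (1ℤ + t)) * y)
      ≈⟨ *-cong (*-cong (≈-refl {+ 4}) (-‿cong (≈-refl {+ 2 * (1ℤ + t)}) x≈)) y≈ ⟩
    + 4 * (+ 2 * (1ℤ + t) - t) * (1ℤ + t)
      ≡⟨ solve (t ∷ []) ⟩
    + 2 * (1ℤ + t) * (+ 2 * (1ℤ + (1ℤ + t))) * 1ℤ
      ∎)

  closedForm-half⇒1≈0 : ∀ t h → + 2 * h ≈ 1ℤ → ClosedForm t h → 1ℤ ≈ 0ℤ
  closedForm-half⇒1≈0 t h 2h≈1 h≈ = begin
    1ℤ                         ≡⟨ solve (t ∷ []) ⟩
    (1ℤ + t) * 1ℤ - t          ≈⟨ -‿cong (*-cong (≈-refl {1ℤ + t}) 2h≈1) ≈-refl ⟨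
    (1ℤ + t) * (+ 2 * h) - t   ≡⟨ solve (t ∷ h ∷ []) ⟩
    + 2 * (1ℤ + t) * h - t     ≈⟨ -‿cong h≈ (≈-refl {t}) ⟩
    t - t                      ≡⟨ solve (t ∷ []) ⟩
    0ℤ                         ∎

  closedForm-one : ∀ t → + 2 + t ≈ 0ℤ → ClosedForm t 1ℤ
  closedForm-one t 2+t≈0 = begin
    + 2 * (1ℤ + t) * 1ℤ   ≡⟨ solve (t ∷ []) ⟩
    (+ 2 + t) + t         ≈⟨ +-cong 2+t≈0 (≈-refl {t}) ⟩
    0ℤ + t                ≡⟨ solve (t ∷ []) ⟩
    t                     ∎

  closedForm-linear : ∀ t x → (+ 2 * x - 1ℤ) * t ≈ - (+ 2 * x) → ClosedForm t x
  closedForm-linear t x lin = begin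
    + 2 * (1ℤ + t) * x                ≡⟨ solve (t ∷ x ∷ []) ⟩
    (+ 2 * x - 1ℤ) * t + (+ 2 * x + t) ≈⟨ +-cong lin (≈-refl {+ 2 * x + t}) ⟩
    - (+ 2 * x) + (+ 2 * x + t)       ≡⟨ solve (t ∷ x ∷ []) ⟩
    t                                 ∎

  linear-at-minus-one⇒1≈0 : ∀ t x → 1ℤ + t ≈ 0ℤ → (+ 2 * x - 1ℤ) * t ≈ - (+ 2 * x) → 1ℤ ≈ 0ℤ
  linear-at-minus-one⇒1≈0 t x 1+t≈0 lin = begin
    1ℤ
      ≡⟨ solve (t ∷ x ∷ []) ⟩
    ((+ 2 * x - 1ℤ) * t + + 2 * x) - (+ 2 * x - 1ℤ) * (1ℤ + t)
      ≈⟨ -‿cong (+-cong lin (≈-refl {+ 2 * x})) (*-cong (≈-refl {+ 2 * x - 1ℤ}) 1+t≈0) ⟩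
    (- (+ 2 * x) + + 2 * x) - (+ 2 * x - 1ℤ) * 0ℤ
      ≡⟨ solve (x ∷ []) ⟩
    0ℤ
      ∎

module PrimeModulus (p : ℕ) .{{_ : NonZero p}} (p-prime : Prime p) where

  open Congruence p
  open import Data.Integer using (+_; _+_; _*_; 0ℤ; 1ℤ; _%ℕ_)
  open import Data.Integer.Properties using (pos-*)
  open import Data.Integer.DivMod using (n%ℕd<d)
  open import Data.Nat.Coprimality using (prime⇒coprime; coprime-Bézout)
  open import Data.Nat.GCD using (module Bézout)
  open import Data.Nat.Primality using (prime⇒nonTrivial)
  open import Data.Nat.Properties using (<-irrefl; 1+n≢0)
  open Bézout using (+-; -+)

  1<p : 1 < p
  1<p = ℕ.nonTrivial⇒n>1 p {{prime⇒nonTrivial p-prime}}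

  1≉0 : ¬ 1ℤ ≈ 0ℤ
  1≉0 1≈0 = 1+n≢0 (residue-injective 1<p (ℕ.>-nonZero⁻¹ p) 1≈0)

  +[1+ab]≡1+ab : ∀ a b → + (1 ℕ.+ a ℕ.* b) ≡ 1ℤ + + a * + b
  +[1+ab]≡1+ab a b = cong (λ k → 1ℤ + k) (pos-* a b)

  prime⇒invertible : ∀ {c} → ¬ c ≈ 0ℤ → Invertible c
  prime⇒invertible {c} c≉0 with c %ℕ p | residue-≈ c | n%ℕd<d c p
  ... | zero      | r≈c | _   = ⊥-elim (c≉0 (≈-sym r≈c))
  ... | r@(suc _) | r≈c | r<p with coprime-Bézout (prime⇒coprime p-prime r<p)
  ...   | +- x y eq = invertible-resp-≈ r≈c (bézout⇒invertible₁ (+ x) (+ y)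
                          (trans (sym (+[1+ab]≡1+ab y r)) (trans (cong +_ eq) (pos-* x p))))
  ...   | -+ x y eq = invertible-resp-≈ r≈c (bézout⇒invertible₂ (+ x) (+ y)
                          (trans (sym (+[1+ab]≡1+ab x p)) (trans (cong +_ eq) (pos-* y r))))

  nat-invertible : ∀ {n} → 0 < n → n < p → Invertible (+ n)
  nat-invertible {n} 0<n n<p = prime⇒invertible n≉0
    where
    n≉0 : ¬ + n ≈ 0ℤ
    n≉0 n≈0 = <-irrefl (sym (residue-injective n<p (ℕ.>-nonZero⁻¹ p) n≈0)) 0<n

odd-prime⇒%2≡1 : ∀ {p} → Prime p → p ≢ 2 → p ℕ.% 2 ≡ 1
odd-prime⇒%2≡1 {p} p-prime p≢2 with p ℕ.% 2 in p%2≡r | m%n<n p 2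
... | zero        | _ =
  ⊥-elim ([ (λ ()) , p≢2 ∘ sym ]′ (prime⇒irreducible p-prime (m%n≡0⇒n∣m p 2 p%2≡r)))
... | suc zero    | _ = refl
... | suc (suc _) | s≤s (s≤s ())

odd⇒2*[[n+1]/2]≡n+1 : ∀ n → n ℕ.% 2 ≡ 1 → 2 ℕ.* ((n ℕ.+ 1) ℕ./ 2) ≡ n ℕ.+ 1
odd⇒2*[[n+1]/2]≡n+1 n n%2≡1 = m*[n/m]≡n (m%n≡0⇒n∣m (n ℕ.+ 1) 2
  (trans (%-distribˡ-+ n 1 2) (cong (λ r → (r ℕ.+ 1) ℕ.% 2) n%2≡1)))

module OddPrime (p : ℕ) .{{_ : NonZero p}} (p-prime : Prime p) (p≢2 : p ≢ 2) where

  open Congruence p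
  open CModulo p
  open PrimeModulus p p-prime
  open import Data.Integer using (+_; -_; _+_; _-_; _*_; 1ℤ)
  open import Data.Integer.Properties using (pos-*)
  open import Data.Nat.Properties
    using (m+[n∸m]≡n; ≤∧≢⇒<; *-cancelˡ-<; +-monoʳ-<; +-identityʳ; +-comm)
  open import Data.Nat.Properties using (<⇒≤; ≤-refl; ≤-antisym; ≰⇒>; _≤?_)

  h : ℕ
  h = (p ℕ.+ 1) ℕ./ 2

  q : ℕ
  q = p ℕ.∸ 2

  2+q≡p : 2 ℕ.+ q ≡ p
  2+q≡p = m+[n∸m]≡n 1<p

  2<p : 2 < p
  2<p = ≤∧≢⇒< 1<p (p≢2 ∘ sym)

  2h≡p+1 : 2 ℕ.* h ≡ p ℕ.+ 1
  2h≡p+1 = odd⇒2*[[n+1]/2]≡n+1 p (odd-prime⇒%2≡1 p-prime p≢2)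

  h<p : h < p
  h<p = *-cancelˡ-< 2 h p (subst (ℕ._< 2 ℕ.* p) (sym 2h≡p+1) p+1<2p)
    where
    p+1<2p : p ℕ.+ 1 < 2 ℕ.* p
    p+1<2p = subst (λ k → p ℕ.+ 1 < p ℕ.+ k) (sym (+-identityʳ p)) (+-monoʳ-< p 1<p)

  2h≈1 : + 2 * + h ≈ 1ℤ
  2h≈1 = begin
    + 2 * + h    ≡⟨ pos-* 2 h ⟨
    + (2 ℕ.* h)  ≡⟨ cong +_ (trans 2h≡p+1 (+-comm p 1)) ⟩
    + suc p      ≈⟨ +[1+m]≈1 ⟩
    1ℤ           ∎
    where open ≈-Reasoning

  h↦h : CStep p h h
  h↦h = ↦⇒CStep 1<p h<p h<p (half-↦-half (+ h) 2h≈1)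

  OrbitValue : ℕ → ℕ → Set
  OrbitValue t x = x < p × ClosedForm (+ t) (+ x)

  t≤q⇒1+t<p : ∀ {t} → t ≤ q → suc t < p
  t≤q⇒1+t<p t≤q = subst (_ ≤_) 2+q≡p (s≤s (s≤s t≤q))

  q<t<p⇒1+t≡p : ∀ {t} → q < t → t < p → suc t ≡ p
  q<t<p⇒1+t≡p q<t t<p = ≤-antisym t<p (subst (_≤ _) 2+q≡p (s≤s q<t))

  denominator-invertible : ∀ {t} → t ≤ q → Invertible (+ 2 * (1ℤ + + t))
  denominator-invertible t≤q = *-invertible (nat-invertible z<s 2<p) (nat-invertible z<s (t≤q⇒1+t<p t≤q))

  orbitValue-exists : ∀ {t} → t ≤ q → ∃[ x ] OrbitValue t x
  orbitValue-exists {t} t≤q = invertible-solve (denominator-invertible t≤q) (+ t)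

  orbitValue-unique : ∀ {t x y} → t ≤ q → OrbitValue t x → OrbitValue t y → x ≡ y
  orbitValue-unique t≤q (x<p , x≈) (y<p , y≈) =
    residue-injective x<p y<p (invertible-cancelˡ (denominator-invertible t≤q) (≈-trans x≈ (≈-sym y≈)))

  orbitValue-step : ∀ {t x y} → suc t ≤ q → OrbitValue t x → OrbitValue (suc t) y → CStep p x y
  orbitValue-step {t} 1+t≤q (x<p , x≈) (y<p , y≈) = ↦⇒CStep 1<p x<p y<p
    (closedForm-↦ (+ t) (denominator-invertible (<⇒≤ 1+t≤q)) (denominator-invertible 1+t≤q) x≈ y≈)

  orbitValue-zero : OrbitValue 0 0
  orbitValue-zero = ℕ.>-nonZero⁻¹ p , ≈-refl

  orbitValue-last : OrbitValue q 1
  orbitValue-last = 1<p , closedForm-one (+ q) (≈-trans (≈-reflexive (cong +_ 2+q≡p)) +m≈0)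

  orbitValue≢h : ∀ {t x} → OrbitValue t x → x ≢ h
  orbitValue≢h {t} (_ , x≈) refl = 1≉0 (closedForm-half⇒1≈0 (+ t) (+ h) 2h≈1 x≈)

  2x-1-invertible : ∀ {x} → x < p → x ≢ h → Invertible (+ 2 * + x - 1ℤ)
  2x-1-invertible x<p x≢h = prime⇒invertible λ 2x-1≈0 → x≢h (residue-injective x<p h<p
    (invertible-cancelˡ (nat-invertible z<s 2<p) (≈-trans (a-1≈0⇒a≈1 2x-1≈0) (≈-sym 2h≈1))))

  orbitValue-surjective : ∀ {x} → x < p → x ≢ h → ∃[ t ] (t ≤ q × OrbitValue t x)
  orbitValue-surjective {x} x<p x≢h =
    from-solution (invertible-solve (2x-1-invertible x<p x≢h) (- (+ 2 * + x)))
    where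
    from-solution : ∃[ t ] (t < p × (+ 2 * + x - 1ℤ) * + t ≈ - (+ 2 * + x)) →
                    ∃[ t ] (t ≤ q × OrbitValue t x)
    from-solution (t , t<p , lin) with t ≤? q
    ... | yes t≤q = t , t≤q , x<p , closedForm-linear (+ t) (+ x) lin
    ... | no  t≰q = ⊥-elim (1≉0 (linear-at-minus-one⇒1≈0 (+ t) (+ x)
                      (≈-trans (≈-reflexive (cong +_ (q<t<p⇒1+t≡p (≰⇒> t≰q) t<p))) +m≈0) lin))

  orbit : ∀ t → t ≤ q → ∃[ x ] (OrbitValue t x × CIter p t 0 x)
  orbit zero    _     = 0 , orbitValue-zero , iter-zero (ℕ.>-nonZero⁻¹ p)
  orbit (suc t) 1+t≤q =
    let x , x-val , 0↦x = orbit t (<⇒≤ 1+t≤q)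
        y , y-val       = orbitValue-exists 1+t≤q
    in  y , y-val , CIter-snoc 0↦x (orbitValue-step 1+t≤q x-val y-val)

  orbit-avoids-h : ∀ {x} → ∃[ t ] (t ≤ q × CIter p t 0 x) → x < p × x ≢ h
  orbit-avoids-h (t , t≤q , 0↦x) =
    let y , y-val , 0↦y = orbit t t≤q
        x-val = subst (OrbitValue t) (sym (CIter-deterministic 0↦x 0↦y)) y-val
    in  proj₁ x-val , orbitValue≢h x-val

  orbit-covers : ∀ {x} → x < p × x ≢ h → ∃[ t ] (t ≤ q × CIter p t 0 x)
  orbit-covers (x<p , x≢h) =
    let t , t≤q , x-val = orbitValue-surjective x<p x≢h
        y , y-val , 0↦y = orbit t t≤q
    in  t , t≤q , subst (CIter p t 0) (orbitValue-unique t≤q y-val x-val) 0↦y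

  orbit-ends-at-1 : CIter p q 0 1
  orbit-ends-at-1 =
    let y , y-val , 0↦y = orbit q ≤-refl
    in  subst (CIter p q 0) (orbitValue-unique ≤-refl y-val orbitValue-last) 0↦y

open import Data.Nat using (ℕ; _+_; _∸_; _<_; _≤_; _/_; NonZero)
open import Data.Product using (_×_; ∃-syntax; _,_; map₂; proj₂)
open import Function.Bundles using (_⇔_; mk⇔)

lemma3p3 : (p : ℕ) → .{{_ : NonZero p}} → Prime p → p ≢ 2 →
    ((t : ℕ) → CIter p t ((p + 1) / 2) ((p + 1) / 2))
    × (((t : ℕ) → t ≤ p ∸ 2 → ∃[ x ] CIter p t 0 x)
    × ((x : ℕ) → (∃[ t ] (t ≤ p ∸ 2 × CIter p t 0 x)) ⇔ (x < p × x ≢ (p + 1) / 2))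
    × CIter p (p ∸ 2) 0 1)
lemma3p3 p p-prime p≢2 =
    CIter-fixed-point h↦h
  , (λ t t≤q → map₂ proj₂ (orbit t t≤q))
  , (λ x → mk⇔ orbit-avoids-h orbit-covers)
  , orbit-ends-at-1
  where open OddPrime p p-prime p≢2
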